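{- Writing $\Box F:=\,?!F$ for c-formulas $F$, the following are derivable in QHC: (1) $\cdot\,\Box p\to p$; (2) $\cdot\,\Box p\to\Box\Box p$; (3) $\cdot\,\Box(p\to q)\to(\Box p\to\Box q)$; (4) the rule $p/\Box p$.
   Context: Meta-logical framework. Formulas of a first-order language may contain individual variables and predicate variables. Meta-formulas are built from formulas using meta-conjunction $\&$, meta-implication $\Rightarrow$, and universal meta-quantifiers over individual and predicate variables. A principle $\cdot G$, for a formula $G$, is the meta-formula obtained by universally meta-quantifying all free individual variables of $G$ and then all predicate variables of $G$. A rule $F_1,\dots,F_m/G$ is the meta-formula $\forall^2(\forall^1F_1\,\&\cdots\&\,\forall^1F_m\Rightarrow\forall^1G)$, where $\forall^1$ meta-quantifies the free individual variables of the formula it precedes and $\forall^2$ meta-quantifies all predicate variables occurring. A logic $L$ is given by a derivation system $\mathcal D$, a meta-conjunction of finitely many principles and rules. For a meta-formula $\mathcal F$, $\vdash_L\mathcal F$ means that $\mathcal D\Rightarrow\mathcal F$ is derivable by the natural-deduction meta-rules: introduction and elimination of $\&$, $\Rightarrow$ and the universal meta-quantifiers (elimination allows substituting terms for individual variables and formulas for predicate variables), plus $\alpha$-conversion. Language of QHC. It has individual variables and, for each $n\ge0$, countably many $n$-ary problem variables $\alpha,\beta,\gamma,\delta,\theta,\dots$ and countably many $n$-ary proper predicate variables $p,q,\dots$. - A c-formula is $\top$, $\bot$, an atom $p(x_1,\dots,x_n)$, or $?\Phi$ for an i-formula $\Phi$, closed under the classical connectives $\land,\lor,\to,\leftrightarrow,\neg$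 and quantifiers $\exists,\forall$. - An i-formula is $\checkmark$ (triviality), $\curlywedge$ (absurdity), an atom $\alpha(x_1,\dots,x_n)$, or $!F$ for a c-formula $F$, closed under the intuitionistic connectives $\land,\lor,\to,\leftrightarrow,\neg$ (with $\neg\Phi:=\Phi\to\curlywedge$) and quantifiers $\exists,\forall$. Connectives applied to c-formulas are classical; those applied to i-formulas are intuitionistic. QHC is the logic whose derivation system consists of: - (0a) all laws and rules of classical predicate logic QC, for c-formulas; - (0b) all laws and rules of intuitionistic predicate logic QH, for i-formulas; - the principles $\cdot\,?(\gamma\land\delta)\leftrightarrow ?\gamma\land ?\delta$, $\cdot\,?(\gamma\lor\delta)\leftrightarrow ?\gamma\lor ?\delta$, $\cdot\,?(\gamma\to\delta)\to(?\gamma\to ?\delta)$, $\cdot\,\neg ?\curlywedge$, $\cdot\,?\exists x\,\theta(x)\leftrightarrow\exists x\,?\theta(x)$, $\cdot\,?\forall x\,\theta(x)\to\forall x\,?\theta(x)$, $\cdot\,\gamma\to\,!?\gamma$, $\cdot\,\neg !\bot$, $\cdot\,?!p\to p$, $\cdot\,!p\to\,!?!p$ and $\cdot\,!(p\to q)\to(!p\to !q)$; - the rules $!p/p$ and $p/!p$. -}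

module Defs where

open import Data.Nat using (ℕ; zero; suc)
open import Data.Vec using (Vec; []; map)
open import Data.Empty using (⊥)
open import Relation.Binary.PropositionalEquality using (_≡_)

-- Individual variables are de Bruijn indices (ℕ); the only terms are
-- individual variables.  Quantifiers bind index 0.
-- Predicate variables: for each arity n, countably many proper predicate
-- variables (index k) and countably many problem variables (index k).

infixr 6 _∧ᶜ_ _∧ⁱ_
infixr 5 _∨ᶜ_ _∨ⁱ_
infixr 4 _⇒ᶜ_ _⇒ⁱ_
infix  3 _⇔ᶜ_ _⇔ⁱ_

mutual
  data CForm : Set where
    ⊤ᶜ ⊥ᶜ : CForm
    patom : (n k : ℕ) → Vec ℕ n → CForm
    ⁇_    : IForm → CForm
    _∧ᶜ_ _∨ᶜ_ _⇒ᶜ_ : CForm → CForm → CForm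
    ∀ᶜ ∃ᶜ : CForm → CForm

  data IForm : Set where
    ✓ ⋏   : IForm
    αatom : (n k : ℕ) → Vec ℕ n → IForm
    !_    : CForm → IForm
    _∧ⁱ_ _∨ⁱ_ _⇒ⁱ_ : IForm → IForm → IForm
    ∀ⁱ ∃ⁱ : IForm → IForm

¬ᶜ_ : CForm → CForm
¬ᶜ A = A ⇒ᶜ ⊥ᶜ

¬ⁱ_ : IForm → IForm
¬ⁱ A = A ⇒ⁱ ⋏

_⇔ᶜ_ : CForm → CForm → CForm
A ⇔ᶜ B = (A ⇒ᶜ B) ∧ᶜ (B ⇒ᶜ A)

_⇔ⁱ_ : IForm → IForm → IForm
A ⇔ⁱ B = (A ⇒ⁱ B) ∧ⁱ (B ⇒ⁱ A)

-- Renaming of individual variables (= substitution, since terms are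
-- variables).

lift : (ℕ → ℕ) → ℕ → ℕ
lift ρ zero    = zero
lift ρ (suc n) = suc (ρ n)

mutual
  renC : (ℕ → ℕ) → CForm → CForm
  renC ρ ⊤ᶜ = ⊤ᶜ
  renC ρ ⊥ᶜ = ⊥ᶜ
  renC ρ (patom n k xs) = patom n k (map ρ xs)
  renC ρ (⁇ Φ) = ⁇ renI ρ Φ
  renC ρ (A ∧ᶜ B) = renC ρ A ∧ᶜ renC ρ B
  renC ρ (A ∨ᶜ B) = renC ρ A ∨ᶜ renC ρ B
  renC ρ (A ⇒ᶜ B) = renC ρ A ⇒ᶜ renC ρ B
  renC ρ (∀ᶜ A) = ∀ᶜ (renC (lift ρ) A)
  renC ρ (∃ᶜ A) = ∃ᶜ (renC (lift ρ) A)

  renI : (ℕ → ℕ) → IForm → IForm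
  renI ρ ✓ = ✓
  renI ρ ⋏ = ⋏
  renI ρ (αatom n k xs) = αatom n k (map ρ xs)
  renI ρ (! F) = ! renC ρ F
  renI ρ (A ∧ⁱ B) = renI ρ A ∧ⁱ renI ρ B
  renI ρ (A ∨ⁱ B) = renI ρ A ∨ⁱ renI ρ B
  renI ρ (A ⇒ⁱ B) = renI ρ A ⇒ⁱ renI ρ B
  renI ρ (∀ⁱ A) = ∀ⁱ (renI (lift ρ) A)
  renI ρ (∃ⁱ A) = ∃ⁱ (renI (lift ρ) A)

inst : ℕ → ℕ → ℕ
inst t zero    = t
inst t (suc n) = n

_[_]ᶜ : CForm → ℕ → CForm
A [ t ]ᶜ = renC (inst t) A

_[_]ⁱ : IForm → ℕ → IForm
A [ t ]ⁱ = renI (inst t) A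

↑ᶜ : CForm → CForm
↑ᶜ = renC suc

↑ⁱ : IForm → IForm
↑ⁱ = renI suc

-- Hilbert-style calculi: QC for c-formulas, QH for i-formulas, with the
-- Bernays quantifier rules; plus the QHC principles (all instances) and
-- the rules !p/p and p/!p.  Every rule applies to anything derived, so
-- DerC H G is "G is derivable from the meta-hypotheses ∀¹F, F ∈ H".

mutual
  data DerC (H : CForm → Set) : CForm → Set where
    hyp  : ∀ {A} → H A → DerC H A
    axK  : ∀ {A B} → DerC H (A ⇒ᶜ (B ⇒ᶜ A))
    axS  : ∀ {A B C} → DerC H ((A ⇒ᶜ (B ⇒ᶜ C)) ⇒ᶜ ((A ⇒ᶜ B) ⇒ᶜ (A ⇒ᶜ C)))
    ax∧I : ∀ {A B} → DerC H (A ⇒ᶜ (B ⇒ᶜ (A ∧ᶜ B)))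
    ax∧E₁ : ∀ {A B} → DerC H ((A ∧ᶜ B) ⇒ᶜ A)
    ax∧E₂ : ∀ {A B} → DerC H ((A ∧ᶜ B) ⇒ᶜ B)
    ax∨I₁ : ∀ {A B} → DerC H (A ⇒ᶜ (A ∨ᶜ B))
    ax∨I₂ : ∀ {A B} → DerC H (B ⇒ᶜ (A ∨ᶜ B))
    ax∨E : ∀ {A B C} → DerC H ((A ⇒ᶜ C) ⇒ᶜ ((B ⇒ᶜ C) ⇒ᶜ ((A ∨ᶜ B) ⇒ᶜ C)))
    ax⊥E : ∀ {A} → DerC H (⊥ᶜ ⇒ᶜ A)
    ax⊤I : DerC H ⊤ᶜ
    axDN : ∀ {A} → DerC H (¬ᶜ ¬ᶜ A ⇒ᶜ A)
    ax∀E : ∀ {A} t → DerC H (∀ᶜ A ⇒ᶜ (A [ t ]ᶜ))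
    ax∃I : ∀ {A} t → DerC H ((A [ t ]ᶜ) ⇒ᶜ ∃ᶜ A)
    mp   : ∀ {A B} → DerC H (A ⇒ᶜ B) → DerC H A → DerC H B
    r∀   : ∀ {A B} → DerC H (↑ᶜ B ⇒ᶜ A) → DerC H (B ⇒ᶜ ∀ᶜ A)
    r∃   : ∀ {A B} → DerC H (A ⇒ᶜ ↑ᶜ B) → DerC H (∃ᶜ A ⇒ᶜ B)
    q∧   : ∀ {Φ Ψ} → DerC H (⁇ (Φ ∧ⁱ Ψ) ⇔ᶜ (⁇ Φ) ∧ᶜ (⁇ Ψ))
    q∨   : ∀ {Φ Ψ} → DerC H (⁇ (Φ ∨ⁱ Ψ) ⇔ᶜ (⁇ Φ) ∨ᶜ (⁇ Ψ))
    q⇒   : ∀ {Φ Ψ} → DerC H (⁇ (Φ ⇒ⁱ Ψ) ⇒ᶜ ((⁇ Φ) ⇒ᶜ (⁇ Ψ)))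
    q⋏   : DerC H (¬ᶜ (⁇ ⋏))
    q∃   : ∀ {Φ} → DerC H (⁇ (∃ⁱ Φ) ⇔ᶜ ∃ᶜ (⁇ Φ))
    q∀   : ∀ {Φ} → DerC H (⁇ (∀ⁱ Φ) ⇒ᶜ ∀ᶜ (⁇ Φ))
    q!   : ∀ {F} → DerC H (⁇ (! F) ⇒ᶜ F)
    r!⁻  : ∀ {F} → DerI H (! F) → DerC H F

  data DerI (H : CForm → Set) : IForm → Set where
    axK  : ∀ {A B} → DerI H (A ⇒ⁱ (B ⇒ⁱ A))
    axS  : ∀ {A B C} → DerI H ((A ⇒ⁱ (B ⇒ⁱ C)) ⇒ⁱ ((A ⇒ⁱ B) ⇒ⁱ (A ⇒ⁱ C)))
    ax∧I : ∀ {A B} → DerI H (A ⇒ⁱ (B ⇒ⁱ (A ∧ⁱ B)))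
    ax∧E₁ : ∀ {A B} → DerI H ((A ∧ⁱ B) ⇒ⁱ A)
    ax∧E₂ : ∀ {A B} → DerI H ((A ∧ⁱ B) ⇒ⁱ B)
    ax∨I₁ : ∀ {A B} → DerI H (A ⇒ⁱ (A ∨ⁱ B))
    ax∨I₂ : ∀ {A B} → DerI H (B ⇒ⁱ (A ∨ⁱ B))
    ax∨E : ∀ {A B C} → DerI H ((A ⇒ⁱ C) ⇒ⁱ ((B ⇒ⁱ C) ⇒ⁱ ((A ∨ⁱ B) ⇒ⁱ C)))
    ax⋏E : ∀ {A} → DerI H (⋏ ⇒ⁱ A)
    ax✓I : DerI H ✓
    ax∀E : ∀ {A} t → DerI H (∀ⁱ A ⇒ⁱ (A [ t ]ⁱ))
    ax∃I : ∀ {A} t → DerI H ((A [ t ]ⁱ) ⇒ⁱ ∃ⁱ A)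
    mp   : ∀ {A B} → DerI H (A ⇒ⁱ B) → DerI H A → DerI H B
    r∀   : ∀ {A B} → DerI H (↑ⁱ B ⇒ⁱ A) → DerI H (B ⇒ⁱ ∀ⁱ A)
    r∃   : ∀ {A B} → DerI H (A ⇒ⁱ ↑ⁱ B) → DerI H (∃ⁱ A ⇒ⁱ B)
    i!⁇  : ∀ {Φ} → DerI H (Φ ⇒ⁱ ! (⁇ Φ))
    i¬!⊥ : DerI H (¬ⁱ (! ⊥ᶜ))
    i!!  : ∀ {F} → DerI H (! F ⇒ⁱ ! (⁇ (! F)))
    i!K  : ∀ {F G} → DerI H (! (F ⇒ᶜ G) ⇒ⁱ (! F ⇒ⁱ ! G))
    r!⁺  : ∀ {F} → DerC H F → DerI H (! F)

∅ : CForm → Set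
∅ _ = ⊥

pv : ℕ → CForm
pv k = patom 0 k []

□ : CForm → CForm
□ F = ⁇ (! F)

-- The rules !p/p and p/!p, together with the principle γ → !?γ, make ? a
-- necessitation: an i-derivable Φ gives a derivable ?Φ.  Combined with
-- ?(γ → δ) → (?γ → ?δ), this turns i-derivable implications into implications
-- between their ?-images, and □ = ?! inherits T from ?!p → p, 4 from
-- !p → !?!p and K from !(p → q) → (!p → !q).
module Submission where

open import Defs
open import Data.Product using (_×_; _,_)
open import Relation.Binary.PropositionalEquality using (_≡_; refl)

module _ {H : CForm → Set} where

  ⇒ᶜ-trans : ∀ {A B C} → DerC H (A ⇒ᶜ B) → DerC H (B ⇒ᶜ C) → DerC H (A ⇒ᶜ C)
  ⇒ᶜ-trans f g = mp (mp axS (mp axK g)) f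

  ⁇-necessitation : ∀ {Φ} → DerI H Φ → DerC H (⁇ Φ)
  ⁇-necessitation d = r!⁻ (mp i!⁇ d)

  ⁇-map : ∀ {Φ Ψ} → DerI H (Φ ⇒ⁱ Ψ) → DerC H (⁇ Φ ⇒ᶜ ⁇ Ψ)
  ⁇-map d = mp q⇒ (⁇-necessitation d)

  □-T : ∀ {F} → DerC H (□ F ⇒ᶜ F)
  □-T = q!

  □-4 : ∀ {F} → DerC H (□ F ⇒ᶜ □ (□ F))
  □-4 = ⁇-map i!!

  □-K : ∀ {F G} → DerC H (□ (F ⇒ᶜ G) ⇒ᶜ (□ F ⇒ᶜ □ G))
  □-K = ⇒ᶜ-trans (⁇-map i!K) q⇒

  □-necessitation : ∀ {F} → DerC H F → DerC H (□ F)
  □-necessitation d = ⁇-necessitation (r!⁺ d)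

mainTheorem9 : (∀ k → DerC ∅ (□ (pv k) ⇒ᶜ pv k))
    × (∀ k → DerC ∅ (□ (pv k) ⇒ᶜ □ (□ (pv k))))
    × (∀ k l → DerC ∅ (□ (pv k ⇒ᶜ pv l) ⇒ᶜ (□ (pv k) ⇒ᶜ □ (pv l))))
    × (∀ k → DerC (_≡ pv k) (□ (pv k)))
mainTheorem9 =
    (λ k → □-T)
  , (λ k → □-4)
  , (λ k l → □-K)
  , (λ k → □-necessitation (hyp refl))
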